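{- For positive integers $k$ and $n$, every Gallai $k$-coloring $\phi$ of $K_n$ satisfies \[ w(\phi,k)\le (k-1)2^{n}-(k-2). \]
   Context: An edge coloring of a complete graph is a Gallai coloring if it contains no triangle whose three edges have three distinct colors; a Gallai $k$-coloring of $K_n$ is a Gallai coloring $E(K_n)\to[k]=\{1,\dots,k\}$ (not necessarily using all colors). For such $\phi$, $w(\phi,k)$ denotes the number of ways to extend $\phi$ to a Gallai coloring of $E(K_{n+1})$ (obtained by adding one new vertex joined to all vertices of $K_n$) in which the new edges receive colors from $[k]$. -}

module Defs where

open import Data.Nat using (ℕ; zero; suc; NonZero)
open import Data.Fin using (Fin; zero; suc)
open import Data.Fin.Properties using (all?) renaming (_≟_ to _≟ᶠ_)
open import Data.List using (List; []; _∷_; map; concatMap; filter; length)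
open import Data.Fin.Base using () 
open import Data.List using () renaming ([_] to single)
open import Data.Product using (_×_)
open import Relation.Binary.PropositionalEquality using (_≡_; _≢_)
open import Relation.Nullary using (¬_; Dec)
open import Relation.Nullary.Decidable using (¬?; _×-dec_; _→-dec_)
import Data.List as L

-- An edge colouring of K_n with colours in [k] = Fin k.
-- Vertices are Fin n; the colour of edge {i,j} (i ≢ j) is c i j.
-- Diagonal values c i i are meaningless and never inspected.
Coloring : ℕ → ℕ → Set
Coloring k n = Fin n → Fin n → Fin k

Symmetric : ∀ {k n} → Coloring k n → Set
Symmetric {n = n} c = (i j : Fin n) → i ≢ j → c i j ≡ c j i

NoRainbowTriangle : ∀ {k n} → Coloring k n → Set
NoRainbowTriangle {n = n} c =
  (i j l : Fin n) → i ≢ j → j ≢ l → i ≢ l →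
  ¬ (c i j ≢ c j l × c j l ≢ c i l × c i j ≢ c i l)

IsGallai : ∀ {k n} → Coloring k n → Set
IsGallai c = Symmetric c × NoRainbowTriangle c

isGallai? : ∀ {k n} (c : Coloring k n) → Dec (IsGallai c)
isGallai? {k} {n} c =
  all? (λ i → all? (λ j → ¬? (i ≟ᶠ j) →-dec (c i j ≟ᶠ c j i)))
  ×-dec
  all? (λ i → all? (λ j → all? (λ l →
     ¬? (i ≟ᶠ j) →-dec (¬? (j ≟ᶠ l) →-dec (¬? (i ≟ᶠ l) →-dec
       ¬? (¬? (c i j ≟ᶠ c j l) ×-dec (¬? (c j l ≟ᶠ c i l) ×-dec ¬? (c i j ≟ᶠ c i l))))))))

someColor : ∀ k .{{_ : NonZero k}} → Fin k
someColor (suc k) = zero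

-- Extension of c to K_{n+1}: the new vertex is 'zero', old vertex i becomes 'suc i',
-- and the new edge {new, i} gets colour e i.
extend : ∀ {k n} .{{_ : NonZero k}} → Coloring k n → (Fin n → Fin k) → Coloring k (suc n)
extend {k} c e zero    zero    = someColor k
extend     c e zero    (suc j) = e j
extend     c e (suc i) zero    = e i
extend     c e (suc i) (suc j) = c i j

allFuns : ∀ n k → List (Fin n → Fin k)
allFuns zero    k = single (λ ())
allFuns (suc n) k =
  concatMap (λ f → map (λ a → cons a f) (Data.List.allFin k)) (allFuns n k)
  where
    cons : ∀ {n} → Fin k → (Fin n → Fin k) → Fin (suc n) → Fin k
    cons a f zero    = a
    cons a f (suc i) = f i

w : ∀ {k n} .{{_ : NonZero k}} → Coloring k n → ℕ
w {k} {n} c = length (filter (λ e → isGallai? (extend c e)) (allFuns n k))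

-- Fix a vertex v of K_n.  A Gallai extension of φ restricts to a Gallai extension f
-- of φ − v, and is determined by f together with the colour a of the new edge to v.
-- If f(j) ≠ φ(vj) for some j, the triangle on the new vertex, v and j forbids every
-- colour a other than f(j) and φ(vj); otherwise f is the one function φ(v,·) and a
-- is arbitrary.  Hence w(φ) ≤ min(k,2)·w(φ − v) + (k − 2), and w = 1 on K_0;
-- solving this recurrence gives (k − 1)2ⁿ − (k − 2).
module Submission where

open import Defs
open import Data.Nat.Base as ℕ using (ℕ; NonZero; zero; suc; _⊓_; _∸_; z≤n; s≤s; ≢-nonZero⁻¹)
import Data.Nat.Properties as ℕ
open import Data.Nat.ListAction using (sum)
open import Data.Integer as ℤ using (+_; _-_; _*_; _^_; _≤_)
import Data.Integer.Properties as ℤ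
import Data.Integer.Tactic.RingSolver as ℤ-Solver
open import Algebra.Properties.CommutativeSemigroup ℕ.+-commutativeSemigroup using (interchange)
open import Data.Fin using (Fin; zero; suc; punchIn)
open import Data.Fin.Properties using (all?; ¬∀⟶∃¬; punchIn-injective) renaming (_≟_ to _≟ᶠ_)
open import Data.Vec.Functional using (head; tail)
open import Data.List using (List; []; _∷_; _++_; map; concatMap; filter; length; allFin)
open import Data.List.Properties using (length-filter; filter-++; filter-none; length-++; length-map; length-tabulate)
open import Data.List.Relation.Unary.All using (All; []; _∷_; universal)
open import Data.List.Relation.Unary.All.Properties using (all-filter) renaming (map⁺ to All-map⁺)
open import Data.List.Relation.Unary.Unique.Propositional using (Unique; []; _∷_)
open import Data.List.Relation.Unary.Unique.Propositional.Properties using (allFin⁺)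
import Data.List.Relation.Unary.Unique.Propositional.Properties as Unique
open import Data.Empty using (⊥-elim)
open import Data.Product using (_,_)
open import Data.Sum using (_⊎_; inj₁; inj₂)
open import Function using (_∘_)
open import Function.Definitions using (Injective)
open import Relation.Nullary using (Dec; yes; no; ¬_)
open import Relation.Nullary.Decidable using (_⊎-dec_)
open import Relation.Unary using (Decidable)
open import Relation.Binary.PropositionalEquality

𝟙 : ∀ {P : Set} → Dec P → ℕ
𝟙 (yes _) = 1
𝟙 (no _)  = 0

count : ∀ {A : Set} {P : A → Set} → Decidable P → List A → ℕ
count P? xs = length (filter P? xs)

module _ {A : Set} {P : A → Set} (P? : Decidable P) where

  count-++ : ∀ xs ys → count P? (xs ++ ys) ≡ count P? xs ℕ.+ count P? ys
  count-++ xs ys = trans (cong length (filter-++ P? xs ys)) (length-++ (filter P? xs))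

  sum-map-𝟙 : ∀ xs → sum (map (𝟙 ∘ P?) xs) ≡ count P? xs
  sum-map-𝟙 [] = refl
  sum-map-𝟙 (x ∷ xs) with P? x
  ... | yes _ = cong suc (sum-map-𝟙 xs)
  ... | no _  = sum-map-𝟙 xs

  count-concatMap-≤ : ∀ {B : Set} (F : B → List A) (h : B → ℕ) →
                      (∀ x → count P? (F x) ℕ.≤ h x) →
                      ∀ xs → count P? (concatMap F xs) ℕ.≤ sum (map h xs)
  count-concatMap-≤ F h bound []       = z≤n
  count-concatMap-≤ F h bound (x ∷ xs) = begin
    count P? (F x ++ concatMap F xs)
      ≡⟨ count-++ (F x) (concatMap F xs) ⟩
    count P? (F x) ℕ.+ count P? (concatMap F xs)
      ≤⟨ ℕ.+-mono-≤ (bound x) (count-concatMap-≤ F h bound xs) ⟩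
    h x ℕ.+ sum (map h xs) ∎
    where open ℕ.≤-Reasoning

  count-map-≤ : ∀ {B : Set} {Q : B → Set} (Q? : Decidable Q) (G : B → A) →
                (∀ b → P (G b) → Q b) → ∀ xs → count P? (map G xs) ℕ.≤ count Q? xs
  count-map-≤ Q? G P⇒Q [] = z≤n
  count-map-≤ Q? G P⇒Q (x ∷ xs) with P? (G x) | Q? x
  ... | yes p | yes _  = s≤s (count-map-≤ Q? G P⇒Q xs)
  ... | yes p | no ¬q  = ⊥-elim (¬q (P⇒Q x p))
  ... | no _  | yes _  = ℕ.m≤n⇒m≤1+n (count-map-≤ Q? G P⇒Q xs)
  ... | no _  | no _   = count-map-≤ Q? G P⇒Q xs

  count-map-≡0 : ∀ {B : Set} (G : B → A) → (∀ b → ¬ P (G b)) → ∀ xs → count P? (map G xs) ≡ 0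
  count-map-≡0 G ¬P xs = cong length (filter-none P? (All-map⁺ (universal ¬P xs)))

sum-map-+ : ∀ {A : Set} (f g : A → ℕ) xs →
            sum (map (λ x → f x ℕ.+ g x) xs) ≡ sum (map f xs) ℕ.+ sum (map g xs)
sum-map-+ f g []       = refl
sum-map-+ f g (x ∷ xs) =
  trans (cong (f x ℕ.+ g x ℕ.+_) (sum-map-+ f g xs)) (interchange (f x) (g x) _ _)

sum-map-*ˡ : ∀ {A : Set} (a : ℕ) (f : A → ℕ) xs →
             sum (map (λ x → a ℕ.* f x) xs) ≡ a ℕ.* sum (map f xs)
sum-map-*ˡ a f []       = sym (ℕ.*-zeroʳ a)
sum-map-*ˡ a f (x ∷ xs) =
  trans (cong (a ℕ.* f x ℕ.+_) (sum-map-*ˡ a f xs)) (sym (ℕ.*-distribˡ-+ a (f x) _))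

sum-map-𝟙-combination : ∀ {A : Set} {P Q : A → Set} (a b : ℕ) (P? : Decidable P) (Q? : Decidable Q) xs →
                        sum (map (λ x → a ℕ.* 𝟙 (P? x) ℕ.+ b ℕ.* 𝟙 (Q? x)) xs)
                          ≡ a ℕ.* count P? xs ℕ.+ b ℕ.* count Q? xs
sum-map-𝟙-combination a b P? Q? xs = begin
  sum (map (λ x → a ℕ.* 𝟙 (P? x) ℕ.+ b ℕ.* 𝟙 (Q? x)) xs)
    ≡⟨ sum-map-+ (λ x → a ℕ.* 𝟙 (P? x)) (λ x → b ℕ.* 𝟙 (Q? x)) xs ⟩
  sum (map (λ x → a ℕ.* 𝟙 (P? x)) xs) ℕ.+ sum (map (λ x → b ℕ.* 𝟙 (Q? x)) xs)
    ≡⟨ cong₂ ℕ._+_ (sum-map-*ˡ a (𝟙 ∘ P?) xs) (sum-map-*ˡ b (𝟙 ∘ Q?) xs) ⟩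
  a ℕ.* sum (map (𝟙 ∘ P?) xs) ℕ.+ b ℕ.* sum (map (𝟙 ∘ Q?) xs)
    ≡⟨ cong₂ (λ s t → a ℕ.* s ℕ.+ b ℕ.* t) (sum-map-𝟙 P? xs) (sum-map-𝟙 Q? xs) ⟩
  a ℕ.* count P? xs ℕ.+ b ℕ.* count Q? xs ∎
  where open ≡-Reasoning

count-⊎-≤ : ∀ {A : Set} {P Q : A → Set} (P? : Decidable P) (Q? : Decidable Q) xs →
            count (λ x → P? x ⊎-dec Q? x) xs ℕ.≤ count P? xs ℕ.+ count Q? xs
count-⊎-≤ P? Q? [] = z≤n
count-⊎-≤ P? Q? (x ∷ xs) with P? x | Q? x
... | yes _ | yes _ = s≤s (ℕ.≤-trans (count-⊎-≤ P? Q? xs) (ℕ.+-monoʳ-≤ (count P? xs) (ℕ.n≤1+n _)))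
... | yes _ | no _  = s≤s (count-⊎-≤ P? Q? xs)
... | no _  | yes _ =
  ℕ.≤-trans (s≤s (count-⊎-≤ P? Q? xs)) (ℕ.≤-reflexive (sym (ℕ.+-suc (count P? xs) _)))
... | no _  | no _  = count-⊎-≤ P? Q? xs

length-constant-unique-≤1 : ∀ {A : Set} {c : A} {xs} → Unique xs → All (_≡ c) xs → length xs ℕ.≤ 1
length-constant-unique-≤1 []                  _               = z≤n
length-constant-unique-≤1 ([] ∷ [])           _               = s≤s z≤n
length-constant-unique-≤1 ((x≢y ∷ _) ∷ _ ∷ _) (x≡c ∷ y≡c ∷ _) = ⊥-elim (x≢y (trans x≡c (sym y≡c)))

count-≡-allFin-≤1 : ∀ {k} (c : Fin k) → count (_≟ᶠ c) (allFin k) ℕ.≤ 1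
count-≡-allFin-≤1 {k} c =
  length-constant-unique-≤1 (Unique.filter⁺ (_≟ᶠ c) (allFin⁺ k)) (all-filter (_≟ᶠ c) (allFin k))

count-allFin-≤ : ∀ {k} {P : Fin k → Set} (P? : Decidable P) → count P? (allFin k) ℕ.≤ k
count-allFin-≤ {k} P? = ℕ.≤-trans (length-filter P? (allFin k)) (ℕ.≤-reflexive (length-tabulate _))

count-two-colours-≤ : ∀ {k} (c d : Fin k) →
                      count (λ a → (a ≟ᶠ c) ⊎-dec (a ≟ᶠ d)) (allFin k) ℕ.≤ 2 ⊓ k
count-two-colours-≤ {k} c d = ℕ.⊓-glb
  (ℕ.≤-trans (count-⊎-≤ (_≟ᶠ c) (_≟ᶠ d) (allFin k))
             (ℕ.+-mono-≤ (count-≡-allFin-≤1 c) (count-≡-allFin-≤1 d)))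
  (count-allFin-≤ _)

_≗?_ : ∀ {m k} (f g : Fin m → Fin k) → Dec (f ≗ g)
f ≗? g = all? (λ j → f j ≟ᶠ g j)

-- allFuns (suc m) k lists, for each f in allFuns m k, the functions G a (a : Fin k)
-- with head a and tail f; as the G of Defs is local, the counting lemmas for one
-- block take any such G.
count-≗-allFuns-≤1 : ∀ {k} m (g : Fin m → Fin k) → count (_≗? g) (allFuns m k) ℕ.≤ 1
count-≗-allFuns-≤1         zero    g = s≤s z≤n
count-≗-allFuns-≤1 {k} (suc m) g = begin
  count (_≗? g) (allFuns (suc m) k)
    ≤⟨ count-concatMap-≤ (_≗? g) _ _ (λ f → count-lifts-≤ f _ (λ _ → refl) (λ _ → refl)) (allFuns m k) ⟩
  sum (map (𝟙 ∘ (_≗? tail g)) (allFuns m k))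
    ≡⟨ sum-map-𝟙 (_≗? tail g) (allFuns m k) ⟩
  count (_≗? tail g) (allFuns m k)
    ≤⟨ count-≗-allFuns-≤1 m (tail g) ⟩
  1 ∎
  where
  open ℕ.≤-Reasoning
  count-lifts-≤ : ∀ f (G : Fin k → Fin (suc m) → Fin k) → (∀ a → head (G a) ≡ a) → (∀ a → tail (G a) ≡ f) →
                  count (_≗? g) (map G (allFin k)) ℕ.≤ 𝟙 (f ≗? tail g)
  count-lifts-≤ f G head-G tail-G with f ≗? tail g
  ... | yes _  = ℕ.≤-trans (count-map-≤ (_≗? g) (_≟ᶠ head g) G head-agrees (allFin k)) (count-≡-allFin-≤1 (head g))
    where
    head-agrees : ∀ a → G a ≗ g → a ≡ head g
    head-agrees a G≗g = trans (sym (head-G a)) (G≗g zero)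
  ... | no f≉g = ℕ.≤-reflexive (count-map-≡0 (_≗? g) G tail-disagrees (allFin k))
    where
    tail-disagrees : ∀ a → ¬ G a ≗ g
    tail-disagrees a G≗g = f≉g (λ j → subst (λ t → t j ≡ g (suc j)) (tail-G a) (G≗g (suc j)))

IsGallai-induced : ∀ {k m n} {c : Coloring k n} {d : Coloring k m} (σ : Fin m → Fin n) →
                   Injective _≡_ _≡_ σ → (∀ x y → d x y ≡ c (σ x) (σ y)) → IsGallai c → IsGallai d
IsGallai-induced σ σ-inj d≡c (sym-c , noRainbow-c) =
  (λ x y x≢y → trans (d≡c x y) (trans (sym-c (σ x) (σ y) (x≢y ∘ σ-inj)) (sym (d≡c y x)))) ,
  λ x y z x≢y y≢z x≢z (xy≢yz , yz≢xz , xy≢xz) →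
    noRainbow-c (σ x) (σ y) (σ z) (x≢y ∘ σ-inj) (y≢z ∘ σ-inj) (x≢z ∘ σ-inj)
      ( (λ e → xy≢yz (trans (d≡c x y) (trans e (sym (d≡c y z)))))
      , (λ e → yz≢xz (trans (d≡c y z) (trans e (sym (d≡c x z)))))
      , (λ e → xy≢xz (trans (d≡c x y) (trans e (sym (d≡c x z))))))

noRainbow-third-edge : ∀ {k n} {c : Coloring k n} → NoRainbowTriangle c → ∀ {i j l} →
                       i ≢ j → j ≢ l → i ≢ l → c j l ≢ c i l → c i j ≡ c j l ⊎ c i j ≡ c i l
noRainbow-third-edge {c = c} noRainbow {i} {j} {l} i≢j j≢l i≢l jl≢il
  with c i j ≟ᶠ c j l | c i j ≟ᶠ c i l
... | yes ij≡jl | _          = inj₁ ij≡jl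
... | no _      | yes ij≡il  = inj₂ ij≡il
... | no ij≢jl  | no ij≢il   = ⊥-elim (noRainbow i j l i≢j j≢l i≢l (ij≢jl , jl≢il , ij≢il))

dropVertex : ∀ {k n} → Coloring k (suc n) → Coloring k n
dropVertex φ i j = φ (suc i) (suc j)

link : ∀ {k n} → Coloring k (suc n) → Fin n → Fin k
link φ j = φ zero (suc j)

module _ {k n : ℕ} .{{_ : NonZero k}} (φ : Coloring k (suc n)) where

  IsGallai-extend-dropVertex : ∀ e → IsGallai (extend φ e) → IsGallai (extend (dropVertex φ) (tail e))
  IsGallai-extend-dropVertex e = IsGallai-induced ι (punchIn-injective (suc zero) _ _) agree
    where
    ι : Fin (suc n) → Fin (suc (suc n))
    ι = punchIn (suc zero)
    agree : ∀ x y → extend (dropVertex φ) (tail e) x y ≡ extend φ e (ι x) (ι y)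
    agree zero    zero    = refl
    agree zero    (suc j) = refl
    agree (suc i) zero    = refl
    agree (suc i) (suc j) = refl

  head-forced : ∀ e → IsGallai (extend φ e) → ∀ j → tail e j ≢ link φ j →
                head e ≡ tail e j ⊎ head e ≡ link φ j
  head-forced e (_ , noRainbow) j e≢φ
    with noRainbow-third-edge noRainbow {zero} {suc zero} {suc (suc j)} (λ ()) (λ ()) (λ ()) (e≢φ ∘ sym)
  ... | inj₁ e₀≡φ = inj₂ e₀≡φ
  ... | inj₂ e₀≡e = inj₁ e₀≡e

  Gallai-extensions-≤ : ∀ f (G : Fin k → Fin (suc n) → Fin k) →
    (∀ a → head (G a) ≡ a) → (∀ a → tail (G a) ≡ f) →
    count (λ e → isGallai? (extend φ e)) (map G (allFin k))
      ℕ.≤ (2 ⊓ k) ℕ.* 𝟙 (isGallai? (extend (dropVertex φ) f)) ℕ.+ (k ∸ 2) ℕ.* 𝟙 (f ≗? link φ)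
  Gallai-extensions-≤ f G head-G tail-G with isGallai? (extend (dropVertex φ) f) | f ≗? link φ
  ... | no ¬gallai | _ = ℕ.≤-trans (ℕ.≤-reflexive (count-map-≡0 _ G restricts (allFin k))) z≤n
    where
    restricts : ∀ a → ¬ IsGallai (extend φ (G a))
    restricts a =
      ¬gallai ∘ subst (IsGallai ∘ extend (dropVertex φ)) (tail-G a) ∘ IsGallai-extend-dropVertex (G a)
  ... | yes _ | yes _ = begin
    count _ (map G (allFin k))             ≤⟨ length-filter _ (map G (allFin k)) ⟩
    length (map G (allFin k))              ≡⟨ trans (length-map G (allFin k)) (length-tabulate _) ⟩
    k                                      ≡⟨ ℕ.m⊓n+n∸m≡n 2 k ⟨
    2 ⊓ k ℕ.+ (k ∸ 2)                      ≡⟨ cong₂ ℕ._+_ (ℕ.*-identityʳ (2 ⊓ k)) (ℕ.*-identityʳ (k ∸ 2)) ⟨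
    (2 ⊓ k) ℕ.* 1 ℕ.+ (k ∸ 2) ℕ.* 1        ∎
    where open ℕ.≤-Reasoning
  ... | yes _ | no f≉link with ¬∀⟶∃¬ n _ (λ j → f j ≟ᶠ link φ j) f≉link
  ... | j , fj≢link = begin
    count _ (map G (allFin k))                                   ≤⟨ count-map-≤ _ _ G forced (allFin k) ⟩
    count (λ a → (a ≟ᶠ f j) ⊎-dec (a ≟ᶠ link φ j)) (allFin k)   ≤⟨ count-two-colours-≤ (f j) (link φ j) ⟩
    2 ⊓ k                                                        ≡⟨ ℕ.+-identityʳ _ ⟨
    2 ⊓ k ℕ.+ 0                                                  ≡⟨ cong₂ ℕ._+_ (ℕ.*-identityʳ (2 ⊓ k)) (ℕ.*-zeroʳ (k ∸ 2)) ⟨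
    (2 ⊓ k) ℕ.* 1 ℕ.+ (k ∸ 2) ℕ.* 0                              ∎
    where
    open ℕ.≤-Reasoning
    forced : ∀ a → IsGallai (extend φ (G a)) → a ≡ f j ⊎ a ≡ link φ j
    forced a gallai = subst₂ (λ x t → x ≡ t j ⊎ x ≡ link φ j) (head-G a) (tail-G a)
      (head-forced (G a) gallai j (fj≢link ∘ subst (λ t → t j ≡ link φ j) (tail-G a)))

  w-recurrence : w φ ℕ.≤ (2 ⊓ k) ℕ.* w (dropVertex φ) ℕ.+ (k ∸ 2)
  w-recurrence = begin
    w φ
      ≤⟨ count-concatMap-≤ _ _ _ (λ f → Gallai-extensions-≤ f _ (λ _ → refl) (λ _ → refl)) fs ⟩
    _
      ≡⟨ sum-map-𝟙-combination (2 ⊓ k) (k ∸ 2) _ (_≗? link φ) fs ⟩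
    (2 ⊓ k) ℕ.* w (dropVertex φ) ℕ.+ (k ∸ 2) ℕ.* count (_≗? link φ) fs
      ≤⟨ ℕ.+-monoʳ-≤ _ (ℕ.*-monoʳ-≤ (k ∸ 2) (count-≗-allFuns-≤1 n (link φ))) ⟩
    (2 ⊓ k) ℕ.* w (dropVertex φ) ℕ.+ (k ∸ 2) ℕ.* 1
      ≡⟨ cong ((2 ⊓ k) ℕ.* w (dropVertex φ) ℕ.+_) (ℕ.*-identityʳ (k ∸ 2)) ⟩
    (2 ⊓ k) ℕ.* w (dropVertex φ) ℕ.+ (k ∸ 2) ∎
    where
    open ℕ.≤-Reasoning
    fs : List (Fin n → Fin k)
    fs = allFuns n k

bound : ℕ → ℕ → ℕ
bound k zero    = 1
bound k (suc n) = (2 ⊓ k) ℕ.* bound k n ℕ.+ (k ∸ 2)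

w-≤-bound : ∀ {k} .{{_ : NonZero k}} n (φ : Coloring k n) → w φ ℕ.≤ bound k n
w-≤-bound {k} zero    φ = length-filter (λ e → isGallai? (extend φ e)) (allFuns zero k)
w-≤-bound {k} (suc n) φ =
  ℕ.≤-trans (w-recurrence φ) (ℕ.+-monoˡ-≤ (k ∸ 2) (ℕ.*-monoʳ-≤ (2 ⊓ k) (w-≤-bound n (dropVertex φ))))

bound-one : ∀ n → bound 1 n ≡ 1
bound-one zero    = refl
bound-one (suc n) = trans (ℕ.+-identityʳ _) (trans (ℕ.+-identityʳ _) (bound-one n))

bound-closed-form : ∀ m n → + bound (suc m) n ≡ (+ suc m - + 1) * (+ 2) ^ n - (+ suc m - + 2)
bound-closed-form zero    n       = cong +_ (bound-one n)
bound-closed-form (suc m) zero    = initial (+ m)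
  where
  initial : ∀ x → + 1 ≡ (+ 2 ℤ.+ x - + 1) * + 1 - (+ 2 ℤ.+ x - + 2)
  initial = ℤ-Solver.solve-∀
bound-closed-form (suc m) (suc n) = begin
  + (2 ℕ.* b ℕ.+ m)                                      ≡⟨ ℤ.pos-+ (2 ℕ.* b) m ⟩
  + (2 ℕ.* b) ℤ.+ + m                                    ≡⟨ cong (ℤ._+ + m) (ℤ.pos-* 2 b) ⟩
  + 2 * + b ℤ.+ + m
    ≡⟨ cong (λ z → + 2 * z ℤ.+ + m) (bound-closed-form (suc m) n) ⟩
  + 2 * ((+ 2 ℤ.+ + m - + 1) * (+ 2) ^ n - (+ 2 ℤ.+ + m - + 2)) ℤ.+ + m
    ≡⟨ step (+ m) ((+ 2) ^ n) ⟩
  (+ 2 ℤ.+ + m - + 1) * (+ 2 * (+ 2) ^ n) - (+ 2 ℤ.+ + m - + 2) ∎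
  where
  open ≡-Reasoning
  b : ℕ
  b = bound (suc (suc m)) n
  -- + 2 ℤ.+ + m computes to + (2 + m), so the solver sees k = 2 + m as a polynomial in m.
  step : ∀ x y → + 2 * ((+ 2 ℤ.+ x - + 1) * y - (+ 2 ℤ.+ x - + 2)) ℤ.+ x
                   ≡ (+ 2 ℤ.+ x - + 1) * (+ 2 * y) - (+ 2 ℤ.+ x - + 2)
  step = ℤ-Solver.solve-∀

lemma2p3 : (k n : ℕ) .{{_ : NonZero k}} .{{_ : NonZero n}} →
    (φ : Coloring k n) → IsGallai φ →
    + (w φ) ≤ (+ k - + 1) * (+ 2) ^ n - (+ k - + 2)
lemma2p3 zero    n φ _ = ⊥-elim (≢-nonZero⁻¹ zero refl)
lemma2p3 (suc m) n φ _ = ℤ.≤-trans (ℤ.+≤+ (w-≤-bound n φ)) (ℤ.≤-reflexive (bound-closed-form m n))
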